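{- Let $n\geq 0$, let $f(m)=2^{2^m}$, and let $$P_n=\Big\{(a,b,c)\in\mathbb{N}^3 : ab=c \text{ and } a,b,c<\prod_{p \text{ prime},\ p<f(n+2)} p\Big\}.$$ Then every deterministic word automaton representing $P_n$ has at least $2^{\lfloor f(n+1)/(2\log_2\varrho)\rfloor}$ states.
   Context: $P_n$ is the set defined by the Fischer–Rabin Presburger formula $\mathrm{Prod}_n(x,y,z)$ (of length linear in $n$). Encoding: fix an integer base $\varrho\geq 2$ and $\Sigma=\{0,\dots,\varrho-1\}$. For $b_{n-1}\dots b_0\in\Sigma^*$ let $\langle b_{n-1}\dots b_0\rangle_{\mathbb N}=\sum_{i<n}\varrho^i b_i$; for $b_nb_{n-1}\dots b_0\in\Sigma^+$ let $\langle b_n\dots b_0\rangle_{\mathbb Z}=\langle b_{n-1}\dots b_0\rangle_{\mathbb N}$ if $b_n=0$ and $\langle b_{n-1}\dots b_0\rangle_{\mathbb N}-\varrho^n$ if $b_n\neq 0$. A word over $\Sigma^3$ is read componentwise (track $i$ encodes the $i$th integer), giving $\langle w\rangle_{\mathbb Z}\in\mathbb{Z}^3$ for $w\in(\Sigma^3)^+$. A deterministic word automaton $\mathcal A$ over $\Sigma^3$ represents $U\subseteq\mathbb{Z}^3$ if $L(\mathcal A)=\{w\in(\Sigma^3)^+:\langle w\rangle_{\mathbb Z}\in U\}$. -}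

module Defs where

open import Data.Nat using (ℕ; zero; suc; _+_; _*_; _^_; _<_; _≤_)
open import Data.Integer using (ℤ; +_) renaming (_-_ to _-ℤ_)
open import Data.Fin using (Fin; toℕ)
open import Data.Bool using (Bool; true; false; T)
open import Data.List using (List; []; _∷_; foldl; filter; upTo; length; map)
open import Data.Nat.Primality using (prime?)
open import Data.Nat.ListAction using (product)
open import Relation.Nullary using (¬_)
open import Data.Product using (Σ; _×_; _,_; proj₁; proj₂)
open import Relation.Binary.PropositionalEquality using (_≡_)

f : ℕ → ℕ
f m = 2 ^ (2 ^ m)

primeProdBelow : ℕ → ℕ
primeProdBelow M = product (filter prime? (upTo M))

InP : ℕ → ℤ × ℤ × ℤ → Set
InP n (x , y , z) =
  Σ ℕ λ a → Σ ℕ λ b → Σ ℕ λ c →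
    (x ≡ + a) × (y ≡ + b) × (z ≡ + c) × (a * b ≡ c) ×
    (a < primeProdBelow (f (n + 2))) × (b < primeProdBelow (f (n + 2))) ×
    (c < primeProdBelow (f (n + 2)))

Letter : ℕ → Set
Letter ϱ = Fin ϱ × Fin ϱ × Fin ϱ

-- ⟨b_{n-1} … b_0⟩_ℕ, word written most-significant digit first
valℕ : (ϱ : ℕ) → List (Fin ϱ) → ℕ
valℕ ϱ = foldl (λ acc d → acc * ϱ + toℕ d) 0

valℤ : (ϱ : ℕ) → Fin ϱ → List (Fin ϱ) → ℤ
valℤ ϱ bn rest with toℕ bn
... | zero  = + valℕ ϱ rest
... | suc _ = + valℕ ϱ rest -ℤ + (ϱ ^ length rest)

decode : (ϱ : ℕ) → Letter ϱ → List (Letter ϱ) → ℤ × ℤ × ℤ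
decode ϱ (a , b , c) w =
  valℤ ϱ a (map proj₁ w) ,
  valℤ ϱ b (map (λ l → proj₁ (proj₂ l)) w) ,
  valℤ ϱ c (map (λ l → proj₂ (proj₂ l)) w)

record DFA (k : ℕ) (A : Set) : Set where
  field
    init   : Fin k
    step   : Fin k → A → Fin k
    accept : Fin k → Bool

  run : List A → Fin k
  run = foldl step init

  Accepts : List A → Set
  Accepts w = T (accept (run w))

Represents : {ϱ k : ℕ} → DFA k (Letter ϱ) → (ℤ × ℤ × ℤ → Set) → Set
Represents {ϱ} 𝒜 U =
  (¬ DFA.Accepts 𝒜 []) ×
  ((d : Letter ϱ) (w : List (Letter ϱ)) →
     (DFA.Accepts 𝒜 (d ∷ w) → U (decode ϱ d w)) ×
     (U (decode ϱ d w) → DFA.Accepts 𝒜 (d ∷ w)))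

module Submission where

-- A DFA for Pₙ needs ϱ ^ t states as soon as (ϱ ^ t)² ≤ ∏_{p < f(n+2)} p.  For b, c < P = ϱ ^ t
-- the word whose tracks read b, P and c · P is a prefix depending only on c followed by a suffix
-- depending only on b, and it encodes a point of Pₙ iff c · P = b · P, i.e. iff c = b.  So the P
-- prefixes form a fooling set, and k ≥ ϱ ^ t ≥ 2 ^ t.
--
-- The hypothesis ϱ ^ (2t) ≤ 2 ^ f(n+1) suffices by a weak Chebyshev bound 2 ^ M ≤ ∏_{p < M²} p
-- for M = f(n+1).  By Legendre's formula no prime power p ^ (E+1) > 2m divides C(2m, m), so
-- C(2m, m) divides (∏_{p ≤ 2m} p) ^ E when 2m < 2 ^ (E+1); and C(2m, m) ≥ 2 ^ m.  With M = 2 ^ a,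
-- E = 2a - 1 and m = M · E this gives (∏_{p < M²} p) ^ E ≥ (2 ^ M) ^ E.

open import Defs
open import Data.Nat
open import Data.Nat.Properties
open import Data.Nat.Divisibility
open import Data.Nat.DivMod
open import Data.Nat.Primality
open import Data.Nat.Primality.Factorisation using (factorise)
open import Data.Nat.Coprimality as Coprime using (Coprime; coprime-divisor)
open import Data.Nat.Combinatorics using (_C_; nCk≡n!/k![n-k]!; k![n∸k]!∣n!; nCk+nC[k+1]≡[n+1]C[k+1])
open import Data.Nat.ListAction.Properties using (∈⇒∣product)
open import Data.Nat.Induction using (<-wellFounded)
open import Data.Nat.Tactic.RingSolver using (solve-∀)
open import Algebra.Properties.CommutativeSemigroup *-commutativeSemigroup
  using (interchange; x∙yz≈z∙xy; x∙yz≈y∙xz)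
open import Induction.WellFounded using (Acc; acc)
import Data.Integer as ℤ
open import Data.Fin using (Fin; toℕ; zero)
open import Data.Fin.Properties using (toℕ-fromℕ<; toℕ-injective; toℕ<n; injective⇒≤; nonZeroIndex)
open import Data.List using (List; []; _∷_; _++_; _∷ʳ_; [_]; upTo; foldl; length; map)
open import Data.List.Properties using (foldl-++; foldl-∷ʳ; map-++; length-++)
open import Data.List.Relation.Unary.Any using (here)
open import Data.List.Relation.Unary.All using (_∷_)
open import Data.List.Relation.Unary.All.Properties using (all-filter)
open import Data.List.Membership.Propositional.Properties using (∈-filter⁺; ∈-upTo⁺)
open import Data.Bool using (T)
open import Data.Product using (∃-syntax; _×_; _,_; proj₁; proj₂)
open import Data.Sum using (_⊎_; inj₁; inj₂; [_,_]′)
open import Function using (_∘_)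
open import Relation.Nullary using (¬_; contradiction; yes; no)
open import Relation.Binary.PropositionalEquality
  using (_≡_; refl; sym; trans; cong; cong₂; subst; module ≡-Reasoning)

private
  variable
    a b d m n p : ℕ

^-monoʳ-∣ : ∀ m → a ≤ b → m ^ a ∣ m ^ b
^-monoʳ-∣ m z≤n       = 1∣ _
^-monoʳ-∣ m (s≤s a≤b) = *-monoʳ-∣ m (^-monoʳ-∣ m a≤b)

^-monoˡ-∣ : ∀ k → m ∣ n → m ^ k ∣ n ^ k
^-monoˡ-∣ zero    _   = ∣-refl
^-monoˡ-∣ (suc k) m∣n = *-pres-∣ m∣n (^-monoˡ-∣ k m∣n)

m<n^[1+e]⇒m/n<n^e : ∀ e .{{_ : NonZero n}} → m < n ^ suc e → m / n < n ^ e
m<n^[1+e]⇒m/n<n^e {n} {m} e m<n^[1+e] = m<n*o⇒m/o<n {o = n} (subst (m <_) (*-comm n (n ^ e)) m<n^[1+e])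

coprime-^ˡ : Coprime m n → ∀ k → Coprime (m ^ k) n
coprime-^ˡ _   zero    (i∣1 , _) = ∣1⇒≡1 i∣1
coprime-^ˡ {m} m⊥n (suc k) {i} (i∣m*m^k , i∣n) =
  coprime-^ˡ m⊥n k (coprime-divisor i⊥m i∣m*m^k , i∣n)
  where
  i⊥m : Coprime i m
  i⊥m (j∣i , j∣m) = m⊥n (j∣m , ∣-trans j∣i i∣n)

coprime⇒*∣ : Coprime m n → m ∣ d → n ∣ d → m * n ∣ d
coprime⇒*∣ {m} {n} m⊥n (divides k refl) n∣k*m = subst (m * n ∣_) (*-comm m k)
  (*-monoʳ-∣ m (coprime-divisor (Coprime.sym m⊥n) (subst (n ∣_) (*-comm k m) n∣k*m)))

prime⇒1<p : Prime p → 1 < p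
prime⇒1<p p-prime = nonTrivial⇒n>1 _ {{prime⇒nonTrivial p-prime}}

prime⇒∤1 : Prime p → ¬ p ∣ 1
prime⇒∤1 p-prime p∣1 = >⇒≢ (prime⇒1<p p-prime) (∣1⇒≡1 p∣1)

prime∧∤⇒coprime : Prime p → ¬ p ∣ n → Coprime p n
prime∧∤⇒coprime p-prime p∤n (i∣p , i∣n) with prime⇒irreducible p-prime i∣p
... | inj₁ i≡1  = i≡1
... | inj₂ refl = contradiction i∣n p∤n

∃prime∣ : 1 < n → ∃[ p ] Prime p × p ∣ n
∃prime∣ {n} 1<n with factorise n {{>-nonZero (<-trans z<s 1<n)}}
... | record { factors = [] ; isFactorisation = n≡1 } = contradiction n≡1 (>⇒≢ 1<n)
... | record { factors = p ∷ ps ; isFactorisation = refl ; factorsPrime = p-prime ∷ _ } =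
  p , p-prime , ∈⇒∣product {ns = p ∷ ps} (here refl)

prime∣n!⇒p≤n : Prime p → ∀ n → p ∣ n ! → p ≤ n
prime∣n!⇒p≤n p-prime zero    p∣1  = contradiction p∣1 (prime⇒∤1 p-prime)
prime∣n!⇒p≤n p-prime (suc n) p∣n! with euclidsLemma (suc n) (n !) p-prime p∣n!
... | inj₁ p∣1+n = ∣⇒≤ p∣1+n
... | inj₂ p∣n!  = m≤n⇒m≤1+n (prime∣n!⇒p≤n p-prime n p∣n!)

infix 4 _^_∥_

record _^_∥_ (p a n : ℕ) : Set where
  constructor exact
  field
    cofactor       : ℕ
    p∤cofactor     : ¬ p ∣ cofactor
    n≡p^a*cofactor : n ≡ p ^ a * cofactor

∥⇒∣ : p ^ a ∥ n → p ^ a ∣ n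
∥⇒∣ {p} {a} (exact u _ refl) = divides u (*-comm (p ^ a) u)

∥⇒∤ : .{{NonZero p}} → p ^ a ∥ n → ¬ p ^ suc a ∣ n
∥⇒∤ {p} {a} (exact u p∤u refl) (divides c p^a*u≡c*p^[1+a]) =
  p∤u (divides c (*-cancelˡ-≡ u (c * p) (p ^ a) {{m^n≢0 p a}}
    (trans p^a*u≡c*p^[1+a] (x∙yz≈z∙xy c p (p ^ a)))))

∥-* : Prime p → p ^ a ∥ m → p ^ b ∥ n → p ^ (a + b) ∥ m * n
∥-* {p = p} {a = a} {b = b} p-prime (exact u p∤u refl) (exact w p∤w refl) =
  exact (u * w) ([ p∤u , p∤w ]′ ∘ euclidsLemma u w p-prime) (begin
    p ^ a * u * (p ^ b * w)   ≡⟨ interchange (p ^ a) u (p ^ b) w ⟩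
    p ^ a * p ^ b * (u * w)   ≡⟨ cong (_* (u * w)) (^-distribˡ-+-* p a b) ⟨
    p ^ (a + b) * (u * w)     ∎)
  where open ≡-Reasoning

p^0∥ : ¬ p ∣ n → p ^ 0 ∥ n
p^0∥ {n = n} p∤n = exact n p∤n (sym (*-identityˡ n))

p^1∥p : Prime p → p ^ 1 ∥ p
p^1∥p {p} p-prime = exact 1 (prime⇒∤1 p-prime) (sym (trans (*-identityʳ (p * 1)) (*-identityʳ p)))

∃∥ : 1 < p → ∀ n .{{_ : NonZero n}} → ∃[ a ] p ^ a ∥ n
∃∥ {p} 1<p n = go n (<-wellFounded n)
  where
  go : ∀ n .{{_ : NonZero n}} → Acc _<_ n → ∃[ a ] p ^ a ∥ n
  go n (acc smaller) with p ∣? n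
  ... | no  p∤n              = 0 , p^0∥ p∤n
  ... | yes (divides c refl) with go c {{m*n≢0⇒m≢0 c}} (smaller (m<m*n c p {{m*n≢0⇒m≢0 c}} 1<p))
  ...   | a , exact u p∤u refl =
    suc a , exact u p∤u (trans (*-comm (p ^ a * u) p) (sym (*-assoc p (p ^ a) u)))

prime-power-split : ∀ d .{{_ : NonZero d}} → d ≡ 1 ⊎ ∃[ p ] ∃[ a ] Prime p × p ^ suc a ∥ d
prime-power-split 1                = inj₁ refl
prime-power-split d@(suc (suc _)) with ∃prime∣ {d} (s<s z<s)
... | p , p-prime , p∣d with ∃∥ (prime⇒1<p p-prime) d
...   | suc a , p^[1+a]∥d          = inj₂ (p , a , p-prime , p^[1+a]∥d)
...   | zero  , exact u p∤u d≡1*u =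
  contradiction (subst (p ∣_) (trans d≡1*u (*-identityˡ u)) p∣d) p∤u

prime-powers-∣⇒∣ : ∀ d .{{_ : NonZero d}} → (∀ p a → Prime p → p ^ a ∣ d → p ^ a ∣ n) → d ∣ n
prime-powers-∣⇒∣ {n} d = go d (<-wellFounded d)
  where
  go : ∀ d .{{_ : NonZero d}} → Acc _<_ d → (∀ p a → Prime p → p ^ a ∣ d → p ^ a ∣ n) → d ∣ n
  go d (acc smaller) hyp with prime-power-split d
  ... | inj₁ refl = 1∣ n
  ... | inj₂ (p , a , p-prime , exact d′ p∤d′ refl) =
    coprime⇒*∣ (coprime-^ˡ {p} (prime∧∤⇒coprime p-prime p∤d′) (suc a))
      (hyp p (suc a) p-prime (divides d′ (*-comm (p ^ suc a) d′)))
      (go d′ {{d′≢0}} (smaller d′<d) λ q b q-prime q^b∣d′ →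
        hyp q b q-prime (∣-trans q^b∣d′ (divides (p ^ suc a) refl)))
    where
    d′≢0 : NonZero d′
    d′≢0 = m*n≢0⇒n≢0 (p ^ suc a)
    d′<d : d′ < p ^ suc a * d′
    d′<d = subst (d′ <_) (*-comm d′ (p ^ suc a))
             (m<m*n d′ (p ^ suc a) {{d′≢0}} (^-monoʳ-< p (prime⇒1<p p-prime) {0} {suc a} z<s))

-- Legendre's formula and the central binomial coefficient

-- The multiples p, 2p, …, qp contribute p ^ q · q!, every other factor is prime to p.
factorial-p-part : Prime p → ∀ q r → r < p → ∃[ c ] p ^ q ∥ c × (r + q * p) ! ≡ q ! * c
factorial-p-part {zero} (prime {{()}} _)
factorial-p-part p-prime zero zero _ = 1 , p^0∥ (prime⇒∤1 p-prime) , refl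
factorial-p-part {p} p-prime q (suc r) 1+r<p with factorial-p-part p-prime q r (<-trans (n<1+n r) 1+r<p)
... | c , p^q∥c , [r+qp]!≡q!c = suc (r + q * p) * c , ∥-* p-prime (p^0∥ p∤1+r+qp) p^q∥c , (begin
  suc (r + q * p) * (r + q * p) !   ≡⟨ cong (suc (r + q * p) *_) [r+qp]!≡q!c ⟩
  suc (r + q * p) * (q ! * c)       ≡⟨ x∙yz≈y∙xz (suc (r + q * p)) (q !) c ⟩
  q ! * (suc (r + q * p) * c)       ∎)
  where
  open ≡-Reasoning
  p∤1+r+qp : ¬ p ∣ suc r + q * p
  p∤1+r+qp p∣1+r+qp =
    <⇒≱ 1+r<p (∣⇒≤ (∣m+n∣m⇒∣n (subst (p ∣_) (+-comm (suc r) (q * p)) p∣1+r+qp) (n∣m*n q)))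
factorial-p-part {suc p′} p-prime (suc q) zero _ with factorial-p-part p-prime q p′ ≤-refl
... | c , p^q∥c , [p′+qp]!≡q!c = suc p′ * c , ∥-* p-prime (p^1∥p p-prime) p^q∥c , (begin
  suc (p′ + q * suc p′) * (p′ + q * suc p′) !  ≡⟨ cong (suc (p′ + q * suc p′) *_) [p′+qp]!≡q!c ⟩
  suc (p′ + q * suc p′) * (q ! * c)            ≡⟨ regroup p′ q (q !) c ⟩
  suc q ! * (suc p′ * c)                       ∎)
  where
  open ≡-Reasoning
  regroup : ∀ p′ q f c → suc (p′ + q * suc p′) * (f * c) ≡ (suc q * f) * (suc p′ * c)
  regroup = solve-∀

[δ+[y+y]]/p≡δ′+[y/p+y/p] : ∀ {δ} y .{{_ : NonZero p}} → δ ≤ 1 →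
  ∃[ δ′ ] δ′ ≤ 1 × (δ + (y + y)) / p ≡ δ′ + (y / p + y / p)
[δ+[y+y]]/p≡δ′+[y/p+y/p] {p} {δ} y δ≤1 = s / p , s/p≤1 , (begin-equality
  (δ + (y + y)) / p                       ≡⟨ /-congˡ (cong (λ z → δ + (z + z)) (m≡m%n+[m/n]*n y p)) ⟩
  (δ + ((r + q * p) + (r + q * p))) / p   ≡⟨ /-congˡ (regroup δ r q p) ⟩
  (s + (q + q) * p) / p                   ≡⟨ +-distrib-/-∣ʳ s (n∣m*n (q + q)) ⟩
  s / p + (q + q) * p / p                 ≡⟨ cong (s / p +_) (m*n/n≡m (q + q) p) ⟩
  s / p + (q + q)                         ∎)
  where
  open ≤-Reasoning
  r q s : ℕ
  r = y % p
  q = y / p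
  s = δ + (r + r)
  regroup : ∀ δ r q p → δ + ((r + q * p) + (r + q * p)) ≡ δ + (r + r) + (q + q) * p
  regroup = solve-∀
  s<2p : s < 2 * p
  s<2p = begin
    suc (δ + (r + r))   ≤⟨ s≤s (+-monoˡ-≤ (r + r) δ≤1) ⟩
    suc (suc (r + r))   ≡⟨ cong suc (+-suc r r) ⟨
    suc r + suc r       ≤⟨ +-mono-≤ (m%n<n y p) (m%n<n y p) ⟩
    p + p               ≡⟨ cong (p +_) (+-identityʳ p) ⟨
    2 * p               ∎
  s/p≤1 : s / p ≤ 1
  s/p≤1 = s≤s⁻¹ (m<n*o⇒m/o<n s<2p)

nCk*[k!*[n∸k]!]≡n! : ∀ {n k} → k ≤ n → (n C k) * (k ! * (n ∸ k) !) ≡ n !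
nCk*[k!*[n∸k]!]≡n! {n} {k} k≤n = trans (cong (_* (k ! * (n ∸ k) !)) (nCk≡n!/k![n-k]! k≤n))
                                       (m/n*n≡m {{k !* (n ∸ k) !≢0}} (k![n∸k]!∣n! k≤n))

[m+m]Cm*[m!*m!]≡[m+m]! : ∀ m → ((m + m) C m) * (m ! * m !) ≡ (m + m) !
[m+m]Cm*[m!*m!]≡[m+m]! m =
  subst (λ z → ((m + m) C m) * (m ! * z !) ≡ (m + m) !) (m+n∸m≡n m m) (nCk*[k!*[n∸k]!]≡n! (m≤m+n m m))

nCk≤[1+n]Ck : ∀ n k → n C k ≤ suc n C k
nCk≤[1+n]Ck n zero    = ≤-refl
nCk≤[1+n]Ck n (suc k) = subst (n C suc k ≤_) (nCk+nC[k+1]≡[n+1]C[k+1] n k) (m≤n+m (n C suc k) (n C k))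

nCk≤[1+n]C[1+k] : ∀ n k → n C k ≤ suc n C suc k
nCk≤[1+n]C[1+k] n k = subst (n C k ≤_) (nCk+nC[k+1]≡[n+1]C[k+1] n k) (m≤m+n (n C k) (n C suc k))

2^m≤[m+m]Cm : ∀ m → 2 ^ m ≤ (m + m) C m
2^m≤[m+m]Cm zero    = ≤-refl
2^m≤[m+m]Cm (suc m) = begin
  2 ^ suc m                              ≡⟨ cong (2 ^ m +_) (+-identityʳ (2 ^ m)) ⟩
  2 ^ m + 2 ^ m                          ≤⟨ +-mono-≤ (2^m≤[m+m]Cm m) (2^m≤[m+m]Cm m) ⟩
  (m + m) C m + (m + m) C m              ≤⟨ +-mono-≤ (nCk≤[1+n]Ck (m + m) m) (nCk≤[1+n]C[1+k] (m + m) m) ⟩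
  suc (m + m) C m + suc (m + m) C suc m  ≡⟨ nCk+nC[k+1]≡[n+1]C[k+1] (suc (m + m)) m ⟩
  suc (suc (m + m)) C suc m              ≡⟨ cong (λ z → suc z C suc m) (+-suc m m) ⟨
  (suc m + suc m) C suc m                ∎
  where open ≤-Reasoning

module _ {p : ℕ} (p-prime : Prime p) where

  private instance
    p≢0 : NonZero p
    p≢0 = prime⇒nonZero p-prime

  legendre : ∀ n → p ^ a ∥ (n / p) ! → p ^ (a + n / p) ∥ n !
  legendre {a} n p^a∥[n/p]! with factorial-p-part p-prime (n / p) (n % p) (m%n<n n p)
  ... | c , p^[n/p]∥c , [n%p+[n/p]p]!≡[n/p]!c =
    subst (p ^ (a + n / p) ∥_) (sym n!≡[n/p]!c) (∥-* p-prime p^a∥[n/p]! p^[n/p]∥c)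
    where
    n!≡[n/p]!c : n ! ≡ (n / p) ! * c
    n!≡[n/p]!c = trans (cong _! (m≡m%n+[m/n]*n n p)) [n%p+[n/p]p]!≡[n/p]!c

  p^0∥m! : ∀ m → m < p → p ^ 0 ∥ m !
  p^0∥m! m m<p = p^0∥ (λ p∣m! → <⇒≱ m<p (prime∣n!⇒p≤n p-prime m p∣m!))

  -- Each step of Legendre's recursion v(x!) = ⌊x/p⌋ + v(⌊x/p⌋!) widens the gap between v((2y+δ)!)
  -- and 2 v(y!) by the carry δ′ ≤ 1.
  factorial-valuation-gap : ∀ e y {δ} → δ ≤ 1 → δ + (y + y) < p ^ suc e →
    ∃[ a ] ∃[ b ] p ^ a ∥ (δ + (y + y)) ! × p ^ b ∥ y ! × a ≤ b + b + e
  factorial-valuation-gap zero y {δ} _ x<p*1 =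
    0 , 0 , p^0∥m! _ x<p , p^0∥m! y (≤-<-trans (≤-trans (m≤m+n y y) (m≤n+m (y + y) δ)) x<p) , z≤n
    where
    x<p : δ + (y + y) < p
    x<p = subst (_ <_) (*-identityʳ p) x<p*1
  factorial-valuation-gap (suc e) y {δ} δ≤1 x<p^[2+e]
    with δ′ , δ′≤1 , x/p≡δ′+2[y/p] ← [δ+[y+y]]/p≡δ′+[y/p+y/p] {p} y δ≤1
    with a , b , p^a∥[x/p]! , p^b∥[y/p]! , a≤2b+e ← factorial-valuation-gap e (y / p) δ′≤1
           (subst (_< p ^ suc e) x/p≡δ′+2[y/p] (m<n^[1+e]⇒m/n<n^e (suc e) x<p^[2+e])) =
    a + x / p , b + y / p ,
    legendre x (subst (λ z → p ^ a ∥ z !) (sym x/p≡δ′+2[y/p]) p^a∥[x/p]!) ,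
    legendre y p^b∥[y/p]! ,
    (begin
      a + x / p                     ≡⟨ cong (a +_) x/p≡δ′+2[y/p] ⟩
      a + (δ′ + (q + q))            ≤⟨ +-mono-≤ a≤2b+e (+-monoˡ-≤ (q + q) δ′≤1) ⟩
      (b + b + e) + (1 + (q + q))   ≡⟨ regroup b e q ⟩
      (b + q) + (b + q) + suc e     ∎)
    where
    open ≤-Reasoning
    x q : ℕ
    x = δ + (y + y)
    q = y / p
    regroup : ∀ b e q → (b + b + e) + (1 + (q + q)) ≡ (b + q) + (b + q) + suc e
    regroup = solve-∀

  p^[1+e]∤[m+m]Cm : ∀ m e → m + m < p ^ suc e → ¬ p ^ suc e ∣ (m + m) C m
  p^[1+e]∤[m+m]Cm m e 2m<p^[1+e] p^[1+e]∣C
    with a , b , p^a∥[2m]! , p^b∥m! , a≤2b+e ← factorial-valuation-gap e m z≤n 2m<p^[1+e] =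
    ∥⇒∤ p^a∥[2m]! (begin
      p ^ suc a                     ∣⟨ ^-monoʳ-∣ p (s≤s (subst (a ≤_) (+-comm (b + b) e) a≤2b+e)) ⟩
      p ^ (suc e + (b + b))         ≡⟨ ^-distribˡ-+-* p (suc e) (b + b) ⟩
      p ^ suc e * p ^ (b + b)       ≡⟨ cong (p ^ suc e *_) (^-distribˡ-+-* p b b) ⟩
      p ^ suc e * (p ^ b * p ^ b)   ∣⟨ *-pres-∣ p^[1+e]∣C (*-pres-∣ p^b∣m! p^b∣m!) ⟩
      ((m + m) C m) * (m ! * m !)   ≡⟨ [m+m]Cm*[m!*m!]≡[m+m]! m ⟩
      (m + m) !                     ∎)
    where
    open ∣-Reasoning
    p^b∣m! : p ^ b ∣ m !
    p^b∣m! = ∥⇒∣ p^b∥m!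

-- A Chebyshev-type lower bound for the primorial

prime<X⇒p∣primeProdBelow[X] : ∀ {X} → Prime p → p < X → p ∣ primeProdBelow X
prime<X⇒p∣primeProdBelow[X] p-prime p<X = ∈⇒∣product (∈-filter⁺ prime? (∈-upTo⁺ p<X) p-prime)

primeProdBelow≢0 : ∀ X → NonZero (primeProdBelow X)
primeProdBelow≢0 X = productOfPrimes≢0 (all-filter prime? (upTo X))

[m+m]Cm∣primeProdBelow[X]^e : ∀ m e {X} → m + m < X → m + m < 2 ^ suc e →
  (m + m) C m ∣ primeProdBelow X ^ e
[m+m]Cm∣primeProdBelow[X]^e m e {X} 2m<X 2m<2^[1+e] =
  prime-powers-∣⇒∣ ((m + m) C m) {{C≢0}} p^a∣C⇒p^a∣Q^e
  where
  C≢0 : NonZero ((m + m) C m)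
  C≢0 = >-nonZero (≤-trans (m^n>0 2 m) (2^m≤[m+m]Cm m))
  C∣[m+m]! : (m + m) C m ∣ (m + m) !
  C∣[m+m]! = divides (m ! * m !)
    (trans (sym ([m+m]Cm*[m!*m!]≡[m+m]! m)) (*-comm ((m + m) C m) (m ! * m !)))
  p^a∣C⇒p^a∣Q^e : ∀ p a → Prime p → p ^ a ∣ (m + m) C m → p ^ a ∣ primeProdBelow X ^ e
  p^a∣C⇒p^a∣Q^e _ zero    _       _     = 1∣ _
  p^a∣C⇒p^a∣Q^e p (suc a) p-prime p^a∣C = ∣-trans (^-monoʳ-∣ p 1+a≤e) (^-monoˡ-∣ e p∣Q)
    where
    p∣Q : p ∣ primeProdBelow X
    p∣Q = prime<X⇒p∣primeProdBelow[X] p-prime (≤-<-trans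
            (prime∣n!⇒p≤n p-prime (m + m) (∣-trans (m*n∣⇒m∣ p (p ^ a) p^a∣C) C∣[m+m]!)) 2m<X)
    1+a≤e : suc a ≤ e
    1+a≤e = ≮⇒≥ λ e<1+a → p^[1+e]∤[m+m]Cm p-prime m e
              (<-≤-trans 2m<2^[1+e] (^-monoˡ-≤ (suc e) (prime⇒1<p p-prime)))
              (∣-trans (^-monoʳ-∣ p e<1+a) p^a∣C)

2^m≤primeProdBelow[X]^e : ∀ m e {X} → m + m < X → m + m < 2 ^ suc e → 2 ^ m ≤ primeProdBelow X ^ e
2^m≤primeProdBelow[X]^e m e {X} 2m<X 2m<2^[1+e] = ≤-trans (2^m≤[m+m]Cm m)
  (∣⇒≤ {{m^n≢0 _ e {{primeProdBelow≢0 X}}}} ([m+m]Cm∣primeProdBelow[X]^e m e 2m<X 2m<2^[1+e]))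

4*n≤2^n : 4 ≤ n → 4 * n ≤ 2 ^ n
4*n≤2^n 4≤n with m≤n⇒m<n∨m≡n 4≤n
... | inj₂ refl = ≤-refl
4*n≤2^n {suc n} _ | inj₁ (s≤s 4≤n) = begin
  4 * suc n       ≡⟨ *-suc 4 n ⟩
  4 + 4 * n       ≤⟨ +-mono-≤ (^-monoʳ-≤ 2 (≤-trans (s≤s (s≤s z≤n)) 4≤n)) (4*n≤2^n 4≤n) ⟩
  2 ^ n + 2 ^ n   ≡⟨ cong (2 ^ n +_) (+-identityʳ (2 ^ n)) ⟨
  2 ^ suc n       ∎
  where open ≤-Reasoning

2^2^a≤primeProdBelow[2^[a+a]] : ∀ {a} → 4 ≤ a → 2 ^ 2 ^ a ≤ primeProdBelow (2 ^ (a + a))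
2^2^a≤primeProdBelow[2^[a+a]] {a@(suc b)} 4≤a = ≮⇒≥ λ Q<2^M → <⇒≱ (begin-strict
    Q ^ E         <⟨ ^-monoˡ-< E {{≢-nonZero (m+1+n≢0 b)}} Q<2^M ⟩
    (2 ^ M) ^ E   ≡⟨ ^-*-assoc 2 M E ⟩
    2 ^ (M * E)   ∎)
  (2^m≤primeProdBelow[X]^e (M * E) E 2ME<X 2ME<X)
  where
  open ≤-Reasoning
  M E Q : ℕ
  M = 2 ^ a
  E = b + suc b
  Q = primeProdBelow (2 ^ (a + a))
  2E<4a : E + E < 4 * a
  2E<4a = subst (suc (E + E) ≤_) (regroup b) (m≤n+m (suc (E + E)) 1)
    where
    regroup : ∀ b → 1 + suc ((b + suc b) + (b + suc b)) ≡ 4 * suc b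
    regroup = solve-∀
  2ME<X : M * E + M * E < 2 ^ (a + a)
  2ME<X = begin-strict
    M * E + M * E   ≡⟨ *-distribˡ-+ M E E ⟨
    M * (E + E)     <⟨ *-monoʳ-< M {{m^n≢0 2 a}} (<-≤-trans 2E<4a (4*n≤2^n 4≤a)) ⟩
    M * M           ≡⟨ ^-distribˡ-+-* 2 a a ⟨
    2 ^ (a + a)     ∎

2^f[n+1]≤primeProdBelow[f[n+2]] : ∀ n → 2 ^ f (n + 1) ≤ primeProdBelow (f (n + 2))
-- The general bound needs 2 ^ (n + 1) ≥ 4; for n = 0 it is 16 ≤ 2 · 3 · 5 · 7 · 11 · 13.
2^f[n+1]≤primeProdBelow[f[n+2]] zero    = ≤ᵇ⇒≤ 16 (primeProdBelow 16) _
2^f[n+1]≤primeProdBelow[f[n+2]] (suc n) =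
  subst (λ z → 2 ^ 2 ^ x ≤ primeProdBelow (2 ^ z)) (sym 2^[n+3]≡x+x) (2^2^a≤primeProdBelow[2^[a+a]] 4≤x)
  where
  x : ℕ
  x = 2 ^ (suc n + 1)
  4≤x : 4 ≤ x
  4≤x = ^-monoʳ-≤ 2 (s≤s (m≤n+m 1 n))
  2^[n+3]≡x+x : 2 ^ (suc n + 2) ≡ x + x
  2^[n+3]≡x+x = trans (cong (2 ^_) (+-suc (suc n) 1)) (cong (x +_) (+-identityʳ x))

-- Fooling sets

module _ {A : Set} {k : ℕ} (𝒜 : DFA k A) where

  open DFA 𝒜

  run-++ : ∀ u v → run (u ++ v) ≡ foldl step (run u) v
  run-++ = foldl-++ step init

  fooling-set-bound : ∀ {N} (u v : Fin N → List A) →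
    (∀ i → Accepts (u i ++ v i)) → (∀ i j → Accepts (u i ++ v j) → i ≡ j) → N ≤ k
  fooling-set-bound u v accepts-uᵢvᵢ accepts-uᵢvⱼ⇒i≡j = injective⇒≤ {f = run ∘ u} run∘u-injective
    where
    run∘u-injective : ∀ {i j} → run (u i) ≡ run (u j) → i ≡ j
    run∘u-injective {i} {j} runᵢ≡runⱼ = sym (accepts-uᵢvⱼ⇒i≡j j i (subst (T ∘ accept) (begin
      run (u i ++ v i)               ≡⟨ run-++ (u i) (v i) ⟩
      foldl step (run (u i)) (v i)   ≡⟨ cong (λ s → foldl step s (v i)) runᵢ≡runⱼ ⟩
      foldl step (run (u j)) (v i)   ≡⟨ run-++ (u j) (v i) ⟨
      run (u j ++ v i)               ∎) (accepts-uᵢvᵢ i)))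
      where open ≡-Reasoning

module _ {ϱ : ℕ} .{{_ : NonZero ϱ}} where

  digits : ℕ → ℕ → List (Fin ϱ)
  digits zero    _ = []
  digits (suc t) x = digits t (x / ϱ) ∷ʳ x mod ϱ

  length-digits : ∀ t x → length (digits t x) ≡ t
  length-digits zero    _ = refl
  length-digits (suc t) x =
    trans (length-++ (digits t (x / ϱ))) (trans (cong (_+ 1) (length-digits t (x / ϱ))) (+-comm t 1))

  horner : ∀ n ds → foldl (λ m d → m * ϱ + toℕ d) n ds ≡ n * ϱ ^ length ds + valℕ ϱ ds
  horner n []       = sym (trans (+-identityʳ (n * 1)) (*-identityʳ n))
  horner n (d ∷ ds) = begin
    foldl _ (n * ϱ + toℕ d) ds
      ≡⟨ horner (n * ϱ + toℕ d) ds ⟩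
    (n * ϱ + toℕ d) * ϱ ^ length ds + valℕ ϱ ds
      ≡⟨ regroup n ϱ (toℕ d) (ϱ ^ length ds) (valℕ ϱ ds) ⟩
    n * (ϱ * ϱ ^ length ds) + (toℕ d * ϱ ^ length ds + valℕ ϱ ds)
      ≡⟨ cong (n * ϱ ^ length (d ∷ ds) +_) (horner (toℕ d) ds) ⟨
    n * ϱ ^ length (d ∷ ds) + valℕ ϱ (d ∷ ds)
      ∎
    where
    open ≡-Reasoning
    regroup : ∀ n ϱ d P v → (n * ϱ + d) * P + v ≡ n * (ϱ * P) + (d * P + v)
    regroup = solve-∀

  valℕ-++ : ∀ ds es → valℕ ϱ (ds ++ es) ≡ valℕ ϱ ds * ϱ ^ length es + valℕ ϱ es
  valℕ-++ ds es = trans (foldl-++ _ 0 ds es) (horner (valℕ ϱ ds) es)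

  valℕ-digits : ∀ t x → x < ϱ ^ t → valℕ ϱ (digits t x) ≡ x
  valℕ-digits zero    zero    _          = refl
  valℕ-digits zero    (suc _) (s≤s ())
  valℕ-digits (suc t) x x<ϱ^[1+t] = begin
    valℕ ϱ (digits t (x / ϱ) ∷ʳ x mod ϱ)
      ≡⟨ foldl-∷ʳ _ 0 (x mod ϱ) (digits t (x / ϱ)) ⟩
    valℕ ϱ (digits t (x / ϱ)) * ϱ + toℕ (x mod ϱ)
      ≡⟨ cong₂ (λ v d → v * ϱ + d) [x/ϱ]≡ (toℕ-fromℕ< (m%n<n x ϱ)) ⟩
    x / ϱ * ϱ + x % ϱ
      ≡⟨ +-comm (x / ϱ * ϱ) (x % ϱ) ⟩
    x % ϱ + x / ϱ * ϱ
      ≡⟨ m≡m%n+[m/n]*n x ϱ ⟨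
    x
      ∎
    where
    open ≡-Reasoning
    [x/ϱ]≡ : valℕ ϱ (digits t (x / ϱ)) ≡ x / ϱ
    [x/ϱ]≡ = valℕ-digits t (x / ϱ) (m<n^[1+e]⇒m/n<n^e t x<ϱ^[1+t])

  valℕ-digits-++ : ∀ t x y → x < ϱ ^ t → y < ϱ ^ t →
    valℕ ϱ (digits t x ++ digits t y) ≡ x * ϱ ^ t + y
  valℕ-digits-++ t x y x<ϱ^t y<ϱ^t = begin
    valℕ ϱ (digits t x ++ digits t y)
      ≡⟨ valℕ-++ (digits t x) (digits t y) ⟩
    valℕ ϱ (digits t x) * ϱ ^ length (digits t y) + valℕ ϱ (digits t y)
      ≡⟨ cong (λ l → valℕ ϱ (digits t x) * ϱ ^ l + valℕ ϱ (digits t y)) (length-digits t y) ⟩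
    valℕ ϱ (digits t x) * ϱ ^ t + valℕ ϱ (digits t y)
      ≡⟨ cong₂ (λ x y → x * ϱ ^ t + y) (valℕ-digits t x x<ϱ^t) (valℕ-digits t y y<ϱ^t) ⟩
    x * ϱ ^ t + y
      ∎
    where open ≡-Reasoning

  digits³ : ℕ → ℕ × ℕ × ℕ → List (Letter ϱ)
  digits³ zero    _           = []
  digits³ (suc t) (x , y , z) = digits³ t (x / ϱ , y / ϱ , z / ϱ) ∷ʳ (x mod ϱ , y mod ϱ , z mod ϱ)

  tracks-digits³ : ∀ t x y z →
    map proj₁ (digits³ t (x , y , z)) ≡ digits t x ×
    map (proj₁ ∘ proj₂) (digits³ t (x , y , z)) ≡ digits t y ×
    map (proj₂ ∘ proj₂) (digits³ t (x , y , z)) ≡ digits t z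
  tracks-digits³ zero    _ _ _ = refl , refl , refl
  tracks-digits³ (suc t) x y z with tracks-digits³ t (x / ϱ) (y / ϱ) (z / ϱ)
  ... | track₁ , track₂ , track₃ =
    map-∷ʳ proj₁ track₁ , map-∷ʳ (proj₁ ∘ proj₂) track₂ , map-∷ʳ (proj₂ ∘ proj₂) track₃
    where
    map-∷ʳ : ∀ {ds es} (π : Letter ϱ → Fin ϱ) {d} →
      map π ds ≡ es → map π (ds ∷ʳ d) ≡ es ∷ʳ π d
    map-∷ʳ {ds} π {d} refl = map-++ π ds [ d ]

-- The sign digit: a word starting with it is read as a triple of naturals.
zero³ : ∀ {r} → Letter (suc r)
zero³ = zero , zero , zero

product-word : ∀ {r} → ℕ → ℕ → ℕ → List (Letter (suc r))
product-word t c b = digits³ t (0 , 1 , c) ++ digits³ t (b , 0 , 0)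

decode-product-word : ∀ {r} t {b c} → let ϱ = suc r in 1 < ϱ ^ t → b < ϱ ^ t → c < ϱ ^ t →
  decode ϱ zero³ (product-word t c b) ≡ (ℤ.+ b , ℤ.+ ϱ ^ t , ℤ.+ (c * ϱ ^ t))
decode-product-word {r} t {b} {c} 1<P b<P c<P
  with u₁ , u₂ , u₃ ← tracks-digits³ t 0 1 c
  with v₁ , v₂ , v₃ ← tracks-digits³ t b 0 0 =
  cong₂ _,_ (cong ℤ.+_ track₁) (cong₂ _,_ (cong ℤ.+_ track₂) (cong ℤ.+_ track₃))
  where
  ϱ P : ℕ
  ϱ = suc r
  P = ϱ ^ t
  u v : List (Letter ϱ)
  u = digits³ t (0 , 1 , c)
  v = digits³ t (b , 0 , 0)
  track-value : ∀ (π : Letter ϱ → Fin ϱ) {x y} → map π u ≡ digits t x → map π v ≡ digits t y →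
    x < P → y < P → valℕ ϱ (map π (u ++ v)) ≡ x * P + y
  track-value π {x} {y} πu≡ πv≡ x<P y<P =
    trans (cong (valℕ ϱ) (trans (map-++ π u v) (cong₂ _++_ πu≡ πv≡))) (valℕ-digits-++ t x y x<P y<P)
  0<P : 0 < P
  0<P = <-trans z<s 1<P
  track₁ : valℕ ϱ (map proj₁ (u ++ v)) ≡ b
  track₁ = track-value proj₁ u₁ v₁ 0<P b<P
  track₂ : valℕ ϱ (map (proj₁ ∘ proj₂) (u ++ v)) ≡ P
  track₂ = trans (track-value (proj₁ ∘ proj₂) u₂ v₂ 1<P 0<P) (trans (+-identityʳ (1 * P)) (*-identityˡ P))
  track₃ : valℕ ϱ (map (proj₂ ∘ proj₂) (u ++ v)) ≡ c * P
  track₃ = trans (track-value (proj₂ ∘ proj₂) u₃ v₃ c<P 0<P) (+-identityʳ (c * P))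

InP⇒product : ∀ {n a b c} → InP n (ℤ.+ a , ℤ.+ b , ℤ.+ c) → a * b ≡ c
InP⇒product (_ , _ , _ , refl , refl , refl , a*b≡c , _) = a*b≡c

module ProductWords {r n k} (𝒜 : DFA k (Letter (suc r))) (𝒜-represents-Pₙ : Represents 𝒜 (InP n)) where

  private
    ϱ : ℕ
    ϱ = suc r

  accepts-product-word : ∀ t {b} → 1 < ϱ ^ t → ϱ ^ t * ϱ ^ t ≤ primeProdBelow (f (n + 2)) →
    b < ϱ ^ t → DFA.Accepts 𝒜 (zero³ ∷ product-word t b b)
  accepts-product-word t {b} 1<P P*P≤N b<P =
    proj₂ (proj₂ 𝒜-represents-Pₙ zero³ (product-word t b b)) (subst (InP n)
      (sym (decode-product-word t 1<P b<P b<P))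
      (b , P , b * P , refl , refl , refl , refl , <-≤-trans (<-trans b<P P<P*P) P*P≤N ,
       <-≤-trans P<P*P P*P≤N , <-≤-trans (*-monoˡ-< P b<P) P*P≤N))
    where
    P : ℕ
    P = ϱ ^ t
    instance
      P≢0 : NonZero P
      P≢0 = m^n≢0 ϱ t
    P<P*P : P < P * P
    P<P*P = m<m*n P P 1<P

  accepts-product-word⇒≡ : ∀ t {b c} → 1 < ϱ ^ t → b < ϱ ^ t → c < ϱ ^ t →
    DFA.Accepts 𝒜 (zero³ ∷ product-word t c b) → c ≡ b
  accepts-product-word⇒≡ t {b} {c} 1<P b<P c<P accepted =
    *-cancelʳ-≡ c b (ϱ ^ t) {{m^n≢0 ϱ t}} (sym (InP⇒product {n} (subst (InP n)
      (decode-product-word t 1<P b<P c<P)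
      (proj₁ (proj₂ 𝒜-represents-Pₙ zero³ (product-word t c b)) accepted))))

theorem5p3 : (ϱ : ℕ) → 2 ≤ ϱ → (n : ℕ) → (k : ℕ) → (𝒜 : DFA k (Letter ϱ)) →
    Represents 𝒜 (InP n) →
    (t : ℕ) → ϱ ^ (2 * t) ≤ 2 ^ f (n + 1) → 2 ^ t ≤ k
theorem5p3 _ _ _ k 𝒜 _ zero _ = >-nonZero⁻¹ k {{nonZeroIndex (DFA.init 𝒜)}}
theorem5p3 1 (s≤s ()) _ _ _ _ (suc _) _
theorem5p3 ϱ@(suc (suc r)) 2≤ϱ n k 𝒜 𝒜-represents-Pₙ t@(suc _) ϱ^2t≤2^f[n+1] = begin
  2 ^ t   ≤⟨ ^-monoˡ-≤ t 2≤ϱ ⟩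
  ϱ ^ t   ≤⟨ fooling-set-bound 𝒜 prefix suffix
               (λ i → accepts-product-word t 1<ϱ^t ϱ^t*ϱ^t≤N (toℕ<n i))
               (λ i j → toℕ-injective ∘ accepts-product-word⇒≡ t 1<ϱ^t (toℕ<n j) (toℕ<n i)) ⟩
  k       ∎
  where
  open ≤-Reasoning
  open ProductWords {n = n} 𝒜 𝒜-represents-Pₙ
  prefix suffix : Fin (ϱ ^ t) → List (Letter ϱ)
  prefix i = zero³ ∷ digits³ t (0 , 1 , toℕ i)
  suffix j = digits³ t (toℕ j , 0 , 0)
  1<ϱ^t : 1 < ϱ ^ t
  1<ϱ^t = ^-monoʳ-< ϱ 2≤ϱ {0} {t} z<s
  ϱ^t*ϱ^t≤N : ϱ ^ t * ϱ ^ t ≤ primeProdBelow (f (n + 2))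
  ϱ^t*ϱ^t≤N = begin
    ϱ ^ t * ϱ ^ t         ≡⟨ cong (λ s → ϱ ^ t * ϱ ^ s) (+-identityʳ t) ⟨
    ϱ ^ t * ϱ ^ (t + 0)   ≡⟨ ^-distribˡ-+-* ϱ t (t + 0) ⟨
    ϱ ^ (2 * t)           ≤⟨ ϱ^2t≤2^f[n+1] ⟩
    2 ^ f (n + 1)         ≤⟨ 2^f[n+1]≤primeProdBelow[f[n+2]] n ⟩
    primeProdBelow (f (n + 2)) ∎
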